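{- Let $(V,\preccurlyeq)$ be a preordered set, and consider its underlying undirected graph with edge set $E$, where distinct $u,v\in V$ are adjacent whenever $u\preccurlyeq v$ or $v\preccurlyeq u$. Let $v_0,v_1,\ldots,v_{2n}$ be distinct vertices forming an antihole, i.e. for distinct indices $a,b$ we have $(v_a,v_b)\notin E$ if and only if $b\equiv a\pm 1 \pmod{2n+1}$. Then for every $i$ with $0\le i\le 2n$: if $v_j\preccurlyeq v_i$ for some $j$ with $(v_i,v_j)\in E$, then $v_j\preccurlyeq v_i$ for all $j$ with $(v_i,v_j)\in E$.
   Context: A preorder is a reflexive and transitive relation. A hole is a set of at least four vertices whose induced subgraph is a cycle; an antihole is a hole in the complement graph (so here $2n+1\ge 5$). -}

module Defs where

open import Level using (Level)
open import Data.Nat using (ℕ; suc; _+_; _*_)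
open import Data.Nat.DivMod using (_%_)
open import Data.Fin using (Fin; toℕ)
open import Data.Product using (_×_)
open import Data.Sum using (_⊎_)
open import Relation.Binary.PropositionalEquality using (_≡_; _≢_)

Edge : ∀ {a ℓ} {V : Set a} → (V → V → Set ℓ) → V → V → Set _
Edge _≼_ u v = u ≢ v × (u ≼ v ⊎ v ≼ u)

CycAdj : (n : ℕ) → Fin (suc (2 * n)) → Fin (suc (2 * n)) → Set
CycAdj n a b =
  (toℕ b ≡ (toℕ a + 1) % suc (2 * n)) ⊎ (toℕ a ≡ (toℕ b + 1) % suc (2 * n))

module Submission where

-- Fix a vertex i of the antihole v₀,…,v₂ₙ and read every index
-- as an offset d from i (mod 2n+1).  The vertices adjacent to vᵢ are exactly
-- those at offsets 2 ≤ d < 2n, and two consecutive offsets d, d+1 give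
-- distinct non-adjacent vertices.  In a preorder, if x, y are distinct and
-- non-adjacent, no z satisfies x ≼ z ≼ y.  Hence if the vertex at offset d
-- lies below vᵢ, the vertex at offset d+1 (comparable with vᵢ) cannot lie
-- above it, so it lies below, and conversely.  Comparability is only known
-- up to double negation (the hypothesis characterises NON-adjacency), so
-- "lies below vᵢ" is propagated as a double-negated statement along the whole
-- interval of offsets [2, 2n).  Finally, a neighbour vⱼ above vᵢ would have a
-- consecutive partner in that interval (the interval has ≥ 2 points as n ≥ 2)
-- which lies below vᵢ, again an impossible sandwich.

open import Defs
open import Data.Nat using (ℕ; suc; zero; _*_; _≤_; _<_; _+_; _∸_; z≤n; s≤s; z<s)
open import Data.Nat.Properties
open import Data.Nat.DivMod using (_%_; m%n<n; %-distribˡ-+; m%n%n≡m%n; [m+n]%n≡m%n; m<n⇒m%n≡m)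
open import Data.Fin using (Fin; toℕ; fromℕ<)
open import Data.Fin.Properties using (toℕ-injective; toℕ-fromℕ<; toℕ<n)
open import Data.Product using (∃-syntax; _×_; _,_; proj₁; proj₂)
open import Data.Sum using (_⊎_; inj₁; inj₂; swap)
open import Data.Empty using (⊥; ⊥-elim)
open import Function.Base using (_∘_)
open import Function.Definitions using (Injective)
open import Function.Bundles using (_⇔_; Equivalence)
open import Relation.Nullary using (¬_; yes; no)
open import Relation.Binary.Structures using (IsPreorder)
open import Relation.Binary.PropositionalEquality

module Rotation (m : ℕ) where
  N : ℕ
  N = suc m

  open ≡-Reasoning

  -- b is the cyclic successor of a; Cyc is the cycle on Fin N.
  -- For m = 2 * n, Cyc m is definitionally Defs.CycAdj n.
  Succ : Fin N → Fin N → Set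
  Succ a b = toℕ b ≡ (toℕ a + 1) % N

  Cyc : Fin N → Fin N → Set
  Cyc a b = Succ a b ⊎ Succ b a

  %-absorbˡ : ∀ x y → (x % N + y) % N ≡ (x + y) % N
  %-absorbˡ x y = begin
    (x % N + y) % N           ≡⟨ %-distribˡ-+ (x % N) y N ⟩
    (x % N % N + y % N) % N   ≡⟨ cong (λ t → (t + y % N) % N) (m%n%n≡m%n x N) ⟩
    (x % N + y % N) % N       ≡⟨ %-distribˡ-+ x y N ⟨
    (x + y) % N               ∎

  %-absorbʳ : ∀ x y → (x + y % N) % N ≡ (x + y) % N
  %-absorbʳ x y = begin
    (x + y % N) % N  ≡⟨ cong (_% N) (+-comm x (y % N)) ⟩
    (y % N + x) % N  ≡⟨ %-absorbˡ y x ⟩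
    (y + x) % N      ≡⟨ cong (_% N) (+-comm y x) ⟩
    (x + y) % N      ∎

  _⊕_ : Fin N → ℕ → Fin N
  a ⊕ d = fromℕ< (m%n<n (toℕ a + d) N)

  toℕ-⊕ : ∀ a d → toℕ (a ⊕ d) ≡ (toℕ a + d) % N
  toℕ-⊕ a d = toℕ-fromℕ< (m%n<n (toℕ a + d) N)

  ⊕-assoc : ∀ a d e → (a ⊕ d) ⊕ e ≡ a ⊕ (d + e)
  ⊕-assoc a d e = toℕ-injective (begin
    toℕ ((a ⊕ d) ⊕ e)          ≡⟨ toℕ-⊕ (a ⊕ d) e ⟩
    (toℕ (a ⊕ d) + e) % N      ≡⟨ cong (λ t → (t + e) % N) (toℕ-⊕ a d) ⟩
    ((toℕ a + d) % N + e) % N  ≡⟨ %-absorbˡ (toℕ a + d) e ⟩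
    (toℕ a + d + e) % N        ≡⟨ cong (_% N) (+-assoc (toℕ a) d e) ⟩
    (toℕ a + (d + e)) % N      ≡⟨ toℕ-⊕ a (d + e) ⟨
    toℕ (a ⊕ (d + e))          ∎)

  ⊕-mod : ∀ a d → a ⊕ (d % N) ≡ a ⊕ d
  ⊕-mod a d = toℕ-injective (begin
    toℕ (a ⊕ (d % N))      ≡⟨ toℕ-⊕ a (d % N) ⟩
    (toℕ a + d % N) % N    ≡⟨ %-absorbʳ (toℕ a) d ⟩
    (toℕ a + d) % N        ≡⟨ toℕ-⊕ a d ⟨
    toℕ (a ⊕ d)            ∎)

  ⊕-identity : ∀ a → a ⊕ 0 ≡ a
  ⊕-identity a = toℕ-injective (begin
    toℕ (a ⊕ 0)      ≡⟨ toℕ-⊕ a 0 ⟩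
    (toℕ a + 0) % N  ≡⟨ cong (_% N) (+-identityʳ (toℕ a)) ⟩
    toℕ a % N        ≡⟨ m<n⇒m%n≡m (toℕ<n a) ⟩
    toℕ a            ∎)

  ⊕-period : ∀ a → a ⊕ N ≡ a
  ⊕-period a = toℕ-injective (begin
    toℕ (a ⊕ N)      ≡⟨ toℕ-⊕ a N ⟩
    (toℕ a + N) % N  ≡⟨ [m+n]%n≡m%n (toℕ a) N ⟩
    toℕ a % N        ≡⟨ m<n⇒m%n≡m (toℕ<n a) ⟩
    toℕ a            ∎)

  ⊕-suc : ∀ a d → (a ⊕ d) ⊕ 1 ≡ a ⊕ suc d
  ⊕-suc a d = trans (⊕-assoc a d 1) (cong (a ⊕_) (+-comm d 1))

  offset : Fin N → Fin N → ℕ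
  offset a x = toℕ (x ⊕ (N ∸ toℕ a))

  offset<N : ∀ a x → offset a x < N
  offset<N a x = toℕ<n (x ⊕ (N ∸ toℕ a))

  around : ∀ a d → toℕ a + d + (N ∸ toℕ a) ≡ d + N
  around a d = begin
    toℕ a + d + (N ∸ toℕ a)    ≡⟨ cong (_+ (N ∸ toℕ a)) (+-comm (toℕ a) d) ⟩
    d + toℕ a + (N ∸ toℕ a)    ≡⟨ +-assoc d (toℕ a) (N ∸ toℕ a) ⟩
    d + (toℕ a + (N ∸ toℕ a))  ≡⟨ cong (d +_) (m+[n∸m]≡n (<⇒≤ (toℕ<n a))) ⟩
    d + N                      ∎

  ⊕-offset : ∀ a x → a ⊕ offset a x ≡ x
  ⊕-offset a x = toℕ-injective (begin
    toℕ (a ⊕ offset a x)                    ≡⟨ cong toℕ (cong (a ⊕_) (toℕ-⊕ x k)) ⟩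
    toℕ (a ⊕ ((toℕ x + k) % N))             ≡⟨ cong toℕ (⊕-mod a (toℕ x + k)) ⟩
    toℕ (a ⊕ (toℕ x + k))                   ≡⟨ toℕ-⊕ a (toℕ x + k) ⟩
    (toℕ a + (toℕ x + k)) % N               ≡⟨ cong (_% N) (+-assoc (toℕ a) (toℕ x) k) ⟨
    (toℕ a + toℕ x + k) % N                 ≡⟨ cong (_% N) (around a (toℕ x)) ⟩
    (toℕ x + N) % N                         ≡⟨ [m+n]%n≡m%n (toℕ x) N ⟩
    toℕ x % N                               ≡⟨ m<n⇒m%n≡m (toℕ<n x) ⟩
    toℕ x                                   ∎)
    where k = N ∸ toℕ a

  offset-⊕ : ∀ a {d} → d < N → offset a (a ⊕ d) ≡ d
  offset-⊕ a {d} d<N = begin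
    toℕ ((a ⊕ d) ⊕ k)          ≡⟨ cong toℕ (⊕-assoc a d k) ⟩
    toℕ (a ⊕ (d + k))          ≡⟨ toℕ-⊕ a (d + k) ⟩
    (toℕ a + (d + k)) % N      ≡⟨ cong (_% N) (+-assoc (toℕ a) d k) ⟨
    (toℕ a + d + k) % N        ≡⟨ cong (_% N) (around a d) ⟩
    (d + N) % N                ≡⟨ [m+n]%n≡m%n d N ⟩
    d % N                      ≡⟨ m<n⇒m%n≡m d<N ⟩
    d                          ∎
    where k = N ∸ toℕ a

  ⊕-cancel : ∀ a {d e} → d < N → e < N → a ⊕ d ≡ a ⊕ e → d ≡ e
  ⊕-cancel a d<N e<N eq =
    trans (sym (offset-⊕ a d<N)) (trans (cong (offset a) eq) (offset-⊕ a e<N))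

  cyc-⊕1 : ∀ a → Cyc a (a ⊕ 1)
  cyc-⊕1 a = inj₁ (toℕ-⊕ a 1)

  cyc-⊕m : ∀ a → Cyc a (a ⊕ m)
  cyc-⊕m a = inj₂ (begin
    toℕ a                  ≡⟨ cong toℕ (⊕-period a) ⟨
    toℕ (a ⊕ N)            ≡⟨ cong toℕ (⊕-suc a m) ⟨
    toℕ ((a ⊕ m) ⊕ 1)      ≡⟨ toℕ-⊕ (a ⊕ m) 1 ⟩
    (toℕ (a ⊕ m) + 1) % N  ∎)

  cyc-consecutive : ∀ a d → Cyc (a ⊕ d) (a ⊕ suc d)
  cyc-consecutive a d = inj₁ (trans (cong toℕ (sym (⊕-suc a d))) (toℕ-⊕ (a ⊕ d) 1))

  ⊕-consecutive-distinct : ∀ a {d} → suc d < N → a ⊕ d ≢ a ⊕ suc d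
  ⊕-consecutive-distinct a sd<N eq = 1+n≢n (sym (⊕-cancel a (<-trans (n<1+n _) sd<N) sd<N eq))

  interior-offset : ∀ a x → a ≢ x → ¬ Cyc a x → 2 ≤ offset a x × offset a x < m
  interior-offset a x a≢x ¬cyc = interior (offset a x) refl (offset<N a x)
    where
    located : ∀ {d} → offset a x ≡ d → a ⊕ d ≡ x
    located eq = trans (cong (a ⊕_) (sym eq)) (⊕-offset a x)

    interior : ∀ d → offset a x ≡ d → d < N → 2 ≤ d × d < m
    interior zero eq _ = ⊥-elim (a≢x (trans (sym (⊕-identity a)) (located eq)))
    interior (suc zero) eq _ = ⊥-elim (¬cyc (subst (Cyc a) (located eq) (cyc-⊕1 a)))
    interior (suc (suc d)) eq (s≤s d<m) = s≤s (s≤s z≤n) , ≤∧≢⇒< d<m d≢m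
      where
      d≢m : suc (suc d) ≢ m
      d≢m d≡m = ¬cyc (subst (Cyc a) (located (trans eq d≡m)) (cyc-⊕m a))

  interior-point : ∀ a {d} → 2 ≤ d → d < m → a ≢ a ⊕ d × ¬ Cyc a (a ⊕ d)
  interior-point a {suc zero} (s≤s ()) _
  interior-point a {d@(suc (suc _))} 2≤d d<m = distinct , ¬cyc
    where
    d<N : d < N
    d<N = <-trans d<m (n<1+n m)

    distinct : a ≢ a ⊕ d
    distinct eq = 1+n≢0 (sym (⊕-cancel a z<s d<N (trans (⊕-identity a) eq)))

    ¬cyc : ¬ Cyc a (a ⊕ d)
    ¬cyc (inj₁ succ) = 1+n≢0 (suc-injective (⊕-cancel a d<N (≤-trans 2≤d (<⇒≤ d<N))
                         (toℕ-injective (trans succ (sym (toℕ-⊕ a 1))))))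
    ¬cyc (inj₂ succ) = 1+n≢0 (sym (⊕-cancel a z<s (s≤s d<m)
                         (trans (⊕-identity a) (toℕ-injective
                           (trans succ (trans (sym (toℕ-⊕ (a ⊕ d) 1)) (cong toℕ (⊕-suc a d))))))))

module Comparability {a ℓ} {V : Set a} {_≼_ : V → V → Set ℓ}
  (pre : IsPreorder _≡_ _≼_) where

  open IsPreorder pre using () renaming (trans to ≼-trans)

  private variable x y z c : V

  Apart : V → V → Set _
  Apart x y = x ≢ y × ¬ Edge _≼_ x y

  Edge-sym : Edge _≼_ x y → Edge _≼_ y x
  Edge-sym (x≢y , comparable) = x≢y ∘ sym , swap comparable

  Apart-sym : Apart x y → Apart y x
  Apart-sym (x≢y , ¬edge) = x≢y ∘ sym , ¬edge ∘ Edge-sym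

  no-sandwich : Apart x y → x ≼ z → z ≼ y → ⊥
  no-sandwich (x≢y , ¬edge) x≼z z≼y = ¬edge (x≢y , inj₁ (≼-trans x≼z z≼y))

  -- Comparability is only known up
  -- to double negation, hence so is the conclusion.
  below-spreads : Apart x y → ¬ ¬ Edge _≼_ c y → ¬ ¬ (x ≼ c) → ¬ ¬ (y ≼ c)
  below-spreads apart comparable x≼c ¬y≼c = comparable λ
    { (_ , inj₁ c≼y) → x≼c (λ x≼c → no-sandwich apart x≼c c≼y)
    ; (_ , inj₂ y≼c) → ¬y≼c y≼c }

module Interval {ℓ} (G : ℕ → Set ℓ) (lo hi : ℕ)
  (step : ∀ {d} → lo ≤ d → suc d < hi → (G d → G (suc d)) × (G (suc d) → G d)) where

  to-lo : ∀ {a} → lo ≤ a → a < hi → G a → G lo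
  to-lo lo≤a a<hi g with m≤n⇒m<n∨m≡n lo≤a
  ... | inj₂ refl = g
  to-lo {suc a} _ a<hi g | inj₁ (s≤s lo≤a) =
    to-lo lo≤a (<-trans (n<1+n a) a<hi) (proj₂ (step lo≤a a<hi) g)

  from-lo : ∀ {b} → lo ≤ b → b < hi → G lo → G b
  from-lo lo≤b b<hi g with m≤n⇒m<n∨m≡n lo≤b
  ... | inj₂ refl = g
  from-lo {suc b} _ b<hi g | inj₁ (s≤s lo≤b) =
    proj₁ (step lo≤b b<hi) (from-lo lo≤b (<-trans (n<1+n b) b<hi) g)

  connected : ∀ {a b} → lo ≤ a → a < hi → lo ≤ b → b < hi → G a → G b
  connected lo≤a a<hi lo≤b b<hi = from-lo lo≤b b<hi ∘ to-lo lo≤a a<hi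

consecutive-pair : ∀ {lo hi d} → 2 + lo ≤ hi → lo ≤ d → d < hi →
  ∃[ e ] (lo ≤ e × suc e < hi × (d ≡ e ⊎ d ≡ suc e))
consecutive-pair {lo} {hi} {d} wide lo≤d d<hi with suc d <? hi
... | yes sd<hi = d , lo≤d , sd<hi , inj₁ refl
... | no sd≮hi = top (≤-pred (≤-trans wide (≮⇒≥ sd≮hi))) d<hi
  where
  top : ∀ {d} → suc lo ≤ d → d < hi → ∃[ e ] (lo ≤ e × suc e < hi × (d ≡ e ⊎ d ≡ suc e))
  top {suc e} (s≤s lo≤e) d<hi = e , lo≤e , d<hi , inj₂ refl

module Antihole {a ℓ} {V : Set a} (_≼_ : V → V → Set ℓ) (pre : IsPreorder _≡_ _≼_)
  (n : ℕ) (v : Fin (suc (2 * n)) → V) (v-injective : Injective _≡_ _≡_ v)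
  (antihole : ∀ i j → i ≢ j → ((¬ Edge _≼_ (v i) (v j)) ⇔ CycAdj n i j))
  (i : Fin (suc (2 * n))) where

  open Rotation (2 * n)
  open Comparability pre

  w : ℕ → V
  w d = v (i ⊕ d)

  w-offset : ∀ x → w (offset i x) ≡ v x
  w-offset x = cong v (⊕-offset i x)

  apart : ∀ {x y} → x ≢ y → Cyc x y → Apart (v x) (v y)
  apart x≢y cyc = x≢y ∘ v-injective , Equivalence.from (antihole _ _ x≢y) cyc

  apart-consecutive : ∀ {d} → suc d < N → Apart (w d) (w (suc d))
  apart-consecutive {d} sd<N = apart (⊕-consecutive-distinct i sd<N) (cyc-consecutive i d)

  comparable-interior : ∀ {d} → 2 ≤ d → d < 2 * n → ¬ ¬ Edge _≼_ (v i) (w d)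
  comparable-interior 2≤d d<2n ¬edge =
    let (i≢id , ¬cyc) = interior-point i 2≤d d<2n
    in ¬cyc (Equivalence.to (antihole i _ i≢id) ¬edge)

  neighbour-offset : ∀ {x} → Edge _≼_ (v i) (v x) → 2 ≤ offset i x × offset i x < 2 * n
  neighbour-offset {x} edge = interior-offset i x i≢x (λ cyc → proj₂ (apart i≢x cyc) edge)
    where
    i≢x : i ≢ x
    i≢x i≡x = proj₁ edge (cong v i≡x)

  Below : ℕ → Set ℓ
  Below d = ¬ ¬ (w d ≼ v i)

  below-step : ∀ {d} → 2 ≤ d → suc d < 2 * n → (Below d → Below (suc d)) × (Below (suc d) → Below d)
  below-step {d} 2≤d sd<2n =
      below-spreads pair (comparable-interior (m≤n⇒m≤1+n 2≤d) sd<2n)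
    , below-spreads (Apart-sym pair) (comparable-interior 2≤d (<-trans (n<1+n d) sd<2n))
    where
    pair : Apart (w d) (w (suc d))
    pair = apart-consecutive (<-trans sd<2n (n<1+n (2 * n)))

  all-below : (∃[ k ] (Edge _≼_ (v i) (v k) × (v k ≼ v i))) →
              ∀ {d} → 2 ≤ d → d < 2 * n → Below d
  all-below (k , edge , k≼i) 2≤d d<2n =
    Interval.connected Below 2 (2 * n) below-step 2≤o o<2n 2≤d d<2n below-at-k
    where
    2≤o : 2 ≤ offset i k
    2≤o = proj₁ (neighbour-offset edge)
    o<2n : offset i k < 2 * n
    o<2n = proj₂ (neighbour-offset edge)
    below-at-k : Below (offset i k)
    below-at-k ¬below = ¬below (subst (_≼ v i) (sym (w-offset k)) k≼i)

  above-at : ∀ {j d} → v i ≼ v j → offset i j ≡ d → v i ≼ w d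
  above-at {j} i≼j refl = subst (v i ≼_) (sym (w-offset j)) i≼j

  -- Hence no neighbour vⱼ lies above vᵢ: a consecutive partner of its offset
  -- would lie below vᵢ and vⱼ would sit above it, while the two are apart.
  not-above : 2 ≤ n → (∃[ k ] (Edge _≼_ (v i) (v k) × (v k ≼ v i))) →
              ∀ {j} → Edge _≼_ (v i) (v j) → ¬ (v i ≼ v j)
  not-above n≥2 below {j} edge i≼j
    with consecutive-pair (*-monoʳ-≤ 2 n≥2) (proj₁ (neighbour-offset edge)) (proj₂ (neighbour-offset edge))
  ... | e , 2≤e , se<2n , inj₁ j-at-e =
    all-below below (m≤n⇒m≤1+n 2≤e) se<2n λ se≼i →
      no-sandwich (Apart-sym (apart-consecutive (<-trans se<2n (n<1+n _)))) se≼i (above-at i≼j j-at-e)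
  ... | e , 2≤e , se<2n , inj₂ j-at-se =
    all-below below 2≤e (<-trans (n<1+n e) se<2n) λ e≼i →
      no-sandwich (apart-consecutive (<-trans se<2n (n<1+n _))) e≼i (above-at i≼j j-at-se)

lemma3p5 : ∀ {a ℓ} {V : Set a} (_≼_ : V → V → Set ℓ) → IsPreorder _≡_ _≼_ →
    (n : ℕ) → 2 ≤ n → (v : Fin (suc (2 * n)) → V) → Injective _≡_ _≡_ v →
    (∀ i j → i ≢ j → ((¬ Edge _≼_ (v i) (v j)) ⇔ CycAdj n i j)) →
    ∀ i → (∃[ j ] (Edge _≼_ (v i) (v j) × (v j ≼ v i))) →
    ∀ j → Edge _≼_ (v i) (v j) → v j ≼ v i
lemma3p5 _≼_ pre n n≥2 v v-injective antihole i below j edge with proj₂ edge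
... | inj₂ j≼i = j≼i
... | inj₁ i≼j = ⊥-elim (Antihole.not-above _≼_ pre n v v-injective antihole i n≥2 below edge i≼j)
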